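{- Let $q$ be a power of a prime $p\ge5$ and let $(s,t)\in\mathbb F_q^2$ with $t(1+s+t)\neq0$. Then $\frac{s^3}{t(1+s+t)}=27$ if and only if either (i) $s=\frac34(-1+u^2)$ and $t=-\frac18(1+u)^3$ for some $u\in\mathbb F_q\setminus\{\pm1\}$, or (ii) $(s,t)=(-3,1)$.
   Context: $\mathbb F_q$ is the field with $q$ elements. -}

module Defs where

open import Level using (_⊔_)
open import Algebra.Bundles using (CommutativeRing)
open import Data.Nat using (ℕ; zero; suc)
open import Data.Fin using (Fin)
open import Data.Product using (∃)
open import Relation.Nullary using (¬_)
open import Relation.Binary.Definitions using (Decidable)
open import Relation.Binary.PropositionalEquality using (_≡_)

module FieldOps {c ℓ} (R : CommutativeRing c ℓ) where
  open CommutativeRing R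

  ι : ℕ → Carrier
  ι zero    = 0#
  ι (suc n) = 1# + ι n

record IsFiniteField {c ℓ} (R : CommutativeRing c ℓ) (q : ℕ) : Set (c ⊔ ℓ) where
  open CommutativeRing R
  field
    _⁻¹       : Carrier → Carrier
    1≉0       : ¬ (1# ≈ 0#)
    inverseʳ  : ∀ x → ¬ (x ≈ 0#) → x * (x ⁻¹) ≈ 1#
    _≟_       : Decidable _≈_
    enum      : Fin q → Carrier
    enum-inj  : ∀ i j → enum i ≈ enum j → i ≡ j
    enum-surj : ∀ x → ∃ λ i → enum i ≈ x

-- Over a field with 3 ≠ 0 the cubic s³ = 27 t (1 + s + t) consists of the points (3a(a − 1), −a³)
-- and its singular point (−3, 1): a point with s ≠ −3 has parameter a = −(3t + s)/(s + 3), and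
-- s = −3 forces 27 (t − 1)² = 0.  When also 2 ≠ 0, the substitution u = 2a − 1 gives the stated
-- parametrisation, and u ≠ ±1 because t (1 + s + t) ≠ 0 forces s ≠ 0.  Both 2 and 3 are nonzero in
-- a field with p^k elements, p ≥ 5: there q · 1 = 0, so p · 1 = 0, and n · 1 is invertible whenever
-- n is coprime to p (Bézout).
module Submission where

open import Defs
open import Algebra.Bundles using (CommutativeRing)
open import Data.Nat using (ℕ; _≤_; _^_)
open import Data.Nat.Primality using (Prime)
open import Data.Product using (∃; _×_; _,_; proj₁; proj₂)
open import Data.Sum using (_⊎_; inj₁; inj₂; [_,_]′)
open import Function.Bundles using (_⇔_; mk⇔; Equivalence)
open import Relation.Nullary using (¬_; yes; no; contradiction)
open import Relation.Binary.PropositionalEquality as ≡ using (_≡_; _≢_)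

import Algebra.Properties.CommutativeMonoid.Sum as Sum
import Algebra.Properties.Ring as RingProperties
import Algebra.Properties.Semiring.Mult as SemiringMult
import Algebra.Solver.Ring as RingSolver
open import Algebra.Solver.Ring.AlmostCommutativeRing
  using (fromCommutativeRing; _-Raw-AlmostCommutative⟶_)
open import Data.Fin using (Fin)
open import Data.Fin.Permutation using (Permutation; permutation)
open import Data.Integer as ℤ using (ℤ; +_; -[1+_]; _⊖_; _◃_; sign; ∣_∣)
import Data.Integer.Properties as ℤ
open import Data.Maybe as Maybe using (Maybe)
open import Data.Nat as ℕ using (zero; suc)
import Data.Nat.Properties as ℕ
open import Data.Nat.Coprimality using (Coprime; coprime-Bézout; prime⇒coprime)
open import Data.Nat.GCD using (module Bézout)
open import Data.Sign as Sign using (Sign)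
open import Function using (id; _∘_)
open import Function.Properties.Equivalence using () renaming (trans to ⇔-trans)
open import Level using (_⊔_)
open import Relation.Binary.Consequences using (dec⇒weaklyDec)
open import Relation.Binary.Definitions using (Decidable)

module _ {c ℓ} (R : CommutativeRing c ℓ) where
  open CommutativeRing R
  open FieldOps R
  open RingProperties ring
    using ( -0#≈0#; -‿involutive; -‿+-comm; -‿distribˡ-*; -‿distribʳ-*; -1*x≈-x; xyx⁻¹≈y
          ; +-identityʳ-unique; +-inverseˡ-unique; x∙y⁻¹≈ε⇒x≈y; x≈y⇒x∙y⁻¹≈ε)
  open module Mult = SemiringMult semiring using (×-homo-+; ×1-homo-*)
  open import Relation.Binary.Reasoning.Setoid setoid

  ι≡×1# : ∀ n → ι n ≡ n Mult.× 1#
  ι≡×1# zero    = ≡.refl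
  ι≡×1# (suc n) = ≡.cong (λ x → 1# + x) (ι≡×1# n)

  ι-+ : ∀ m n → ι (m ℕ.+ n) ≈ ι m + ι n
  ι-+ m n rewrite ι≡×1# (m ℕ.+ n) | ι≡×1# m | ι≡×1# n = ×-homo-+ 1# m n

  ι-* : ∀ m n → ι (m ℕ.* n) ≈ ι m * ι n
  ι-* m n rewrite ι≡×1# (m ℕ.* n) | ι≡×1# m | ι≡×1# n = ×1-homo-* m n

  ι≈0⇒ι[x*m]≈0 : ∀ x {m} → ι m ≈ 0# → ι (x ℕ.* m) ≈ 0#
  ι≈0⇒ι[x*m]≈0 x {m} ιm≈0 = trans (ι-* x m) (trans (*-congˡ ιm≈0) (zeroʳ (ι x)))

  ι≈0⇒1+x*m≢y*n : ∀ {m n} → ¬ (1# ≈ 0#) → ι m ≈ 0# → ι n ≈ 0# →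
                   ∀ x y → 1 ℕ.+ x ℕ.* m ≢ y ℕ.* n
  ι≈0⇒1+x*m≢y*n {m} {n} 1≉0 ιm≈0 ιn≈0 x y eq = 1≉0 (begin
    1#                   ≈⟨ +-identityʳ 1# ⟨
    ι 1                  ≈⟨ +-identityʳ (ι 1) ⟨
    ι 1 + 0#             ≈⟨ +-congˡ (ι≈0⇒ι[x*m]≈0 x ιm≈0) ⟨
    ι 1 + ι (x ℕ.* m)    ≈⟨ ι-+ 1 (x ℕ.* m) ⟨
    ι (1 ℕ.+ x ℕ.* m)    ≡⟨ ≡.cong ι eq ⟩
    ι (y ℕ.* n)          ≈⟨ ι≈0⇒ι[x*m]≈0 y ιn≈0 ⟩
    0#                   ∎)

  ι≉0-coprime : ∀ {m n} → ¬ (1# ≈ 0#) → ι m ≈ 0# → Coprime m n → ¬ (ι n ≈ 0#)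
  ι≉0-coprime 1≉0 ιm≈0 m⊥n ιn≈0 with coprime-Bézout m⊥n
  ... | Bézout.+- x y eq = ι≈0⇒1+x*m≢y*n 1≉0 ιn≈0 ιm≈0 y x eq
  ... | Bézout.-+ x y eq = ι≈0⇒1+x*m≢y*n 1≉0 ιm≈0 ιn≈0 x y eq

  module IntegerSolver where

    ιℤ : ℤ → Carrier
    ιℤ (+ n)    = ι n
    ιℤ -[1+ n ] = - ι (suc n)

    ιℤ-⊖ : ∀ m n → ιℤ (m ⊖ n) ≈ ι m - ι n
    ιℤ-⊖ m       zero    = begin
      ιℤ (m ⊖ 0)   ≡⟨ ≡.cong ιℤ (ℤ.⊖-≥ {m} ℕ.z≤n) ⟩
      ι m          ≈⟨ +-identityʳ (ι m) ⟨
      ι m + 0#     ≈⟨ +-congˡ -0#≈0# ⟨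
      ι m - 0#     ∎
    ιℤ-⊖ zero    (suc n) = sym (+-identityˡ (- ι (suc n)))
    ιℤ-⊖ (suc m) (suc n) = begin
      ιℤ (suc m ⊖ suc n)          ≡⟨ ≡.cong ιℤ (ℤ.[1+m]⊖[1+n]≡m⊖n m n) ⟩
      ιℤ (m ⊖ n)                  ≈⟨ ιℤ-⊖ m n ⟩
      ι m - ι n                   ≈⟨ +-congʳ (xyx⁻¹≈y 1# (ι m)) ⟨
      (1# + ι m) + - 1# + - ι n   ≈⟨ +-assoc _ _ _ ⟩
      (1# + ι m) + (- 1# + - ι n) ≈⟨ +-congˡ (-‿+-comm 1# (ι n)) ⟩
      ι (suc m) - ι (suc n)       ∎

    ιℤ-+ : ∀ i j → ιℤ (i ℤ.+ j) ≈ ιℤ i + ιℤ j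
    ιℤ-+ (+ m)    (+ n)    = ι-+ m n
    ιℤ-+ (+ m)    -[1+ n ] = ιℤ-⊖ m (suc n)
    ιℤ-+ -[1+ m ] (+ n)    = trans (ιℤ-⊖ n (suc m)) (+-comm _ _)
    ιℤ-+ -[1+ m ] -[1+ n ] = begin
      - ι (suc (suc (m ℕ.+ n)))   ≡⟨ ≡.cong (λ k → - ι (suc k)) (ℕ.+-suc m n) ⟨
      - ι (suc m ℕ.+ suc n)       ≈⟨ -‿cong (ι-+ (suc m) (suc n)) ⟩
      - (ι (suc m) + ι (suc n))   ≈⟨ -‿+-comm _ _ ⟨
      - ι (suc m) + - ι (suc n)   ∎

    ιℤ-neg : ∀ i → ιℤ (ℤ.- i) ≈ - ιℤ i
    ιℤ-neg (+ zero)  = sym -0#≈0#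
    ιℤ-neg (+ suc n) = refl
    ιℤ-neg -[1+ n ]  = sym (-‿involutive _)

    signed : Sign → Carrier → Carrier
    signed Sign.+ x = x
    signed Sign.- x = - x

    signed-cong : ∀ σ {x y} → x ≈ y → signed σ x ≈ signed σ y
    signed-cong Sign.+ x≈y = x≈y
    signed-cong Sign.- x≈y = -‿cong x≈y

    signed-* : ∀ σ τ x y → signed (σ Sign.* τ) (x * y) ≈ signed σ x * signed τ y
    signed-* Sign.+ Sign.+ x y = refl
    signed-* Sign.+ Sign.- x y = -‿distribʳ-* x y
    signed-* Sign.- Sign.+ x y = -‿distribˡ-* x y
    signed-* Sign.- Sign.- x y = begin
      x * y         ≈⟨ -‿involutive _ ⟨
      - - (x * y)   ≈⟨ -‿cong (-‿distribˡ-* x y) ⟩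
      - (- x * y)   ≈⟨ -‿distribʳ-* (- x) y ⟩
      - x * - y     ∎

    ιℤ-◃ : ∀ σ n → ιℤ (σ ◃ n) ≈ signed σ (ι n)
    ιℤ-◃ Sign.+ n = reflexive (≡.cong ιℤ (ℤ.+◃n≡+n n))
    ιℤ-◃ Sign.- n = trans (reflexive (≡.cong ιℤ (ℤ.-◃n≡-n n))) (ιℤ-neg (+ n))

    ιℤ≈signed : ∀ i → ιℤ i ≈ signed (sign i) (ι ∣ i ∣)
    ιℤ≈signed (+ n)    = refl
    ιℤ≈signed -[1+ n ] = refl

    ιℤ-* : ∀ i j → ιℤ (i ℤ.* j) ≈ ιℤ i * ιℤ j
    ιℤ-* i j = begin
      ιℤ (i ℤ.* j)                        ≈⟨ ιℤ-◃ (σ Sign.* τ) (m ℕ.* n) ⟩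
      signed (σ Sign.* τ) (ι (m ℕ.* n))   ≈⟨ signed-cong (σ Sign.* τ) (ι-* m n) ⟩
      signed (σ Sign.* τ) (ι m * ι n)     ≈⟨ signed-* σ τ (ι m) (ι n) ⟩
      signed σ (ι m) * signed τ (ι n)     ≈⟨ *-cong (ιℤ≈signed i) (ιℤ≈signed j) ⟨
      ιℤ i * ιℤ j                         ∎
      where
      σ = sign i
      τ = sign j
      m = ∣ i ∣
      n = ∣ j ∣

    -- Since ι 1 is 1# + 0#, the coefficients ±1 are sent to ±1# itself, so that the normal forms
    -- computed by the solver mention 1# exactly where the goals do.
    fromℤ : ℤ → Carrier
    fromℤ (+ 1)      = 1#
    fromℤ -[1+ 0 ]   = - 1#
    fromℤ i          = ιℤ i

    fromℤ≈ιℤ : ∀ i → fromℤ i ≈ ιℤ i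
    fromℤ≈ιℤ (+ 0)           = refl
    fromℤ≈ιℤ (+ 1)           = sym (+-identityʳ 1#)
    fromℤ≈ιℤ (+ suc (suc n)) = refl
    fromℤ≈ιℤ -[1+ 0 ]        = -‿cong (sym (+-identityʳ 1#))
    fromℤ≈ιℤ -[1+ suc n ]    = refl

    fromℤ-homomorphism : ℤ.+-*-rawRing -Raw-AlmostCommutative⟶ fromCommutativeRing R
    fromℤ-homomorphism = record
      { ⟦_⟧    = fromℤ
      ; +-homo = λ i j → trans (fromℤ≈ιℤ (i ℤ.+ j))
                           (trans (ιℤ-+ i j) (sym (+-cong (fromℤ≈ιℤ i) (fromℤ≈ιℤ j))))
      ; *-homo = λ i j → trans (fromℤ≈ιℤ (i ℤ.* j))
                           (trans (ιℤ-* i j) (sym (*-cong (fromℤ≈ιℤ i) (fromℤ≈ιℤ j))))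
      ; -‿homo = λ i → trans (fromℤ≈ιℤ (ℤ.- i)) (trans (ιℤ-neg i) (sym (-‿cong (fromℤ≈ιℤ i))))
      ; 0-homo = refl
      ; 1-homo = refl
      }

    coefficient-≟ : ∀ i j → Maybe (fromℤ i ≈ fromℤ j)
    coefficient-≟ i j = Maybe.map (λ { ≡.refl → refl }) (dec⇒weaklyDec ℤ._≟_ i j)

    open RingSolver ℤ.+-*-rawRing (fromCommutativeRing R) fromℤ-homomorphism coefficient-≟ public

  module FiniteRing {q : ℕ} (enum : Fin q → Carrier) (enum-inj : ∀ i j → enum i ≈ enum j → i ≡ j)
                    (enum-surj : ∀ x → ∃ λ i → enum i ≈ x) where
    open Sum +-commutativeMonoid using (sum; ∑-permute; ∑-distrib-+; sum-cong-≋; sum-replicate)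

    shift : Carrier → Fin q → Fin q
    shift x i = proj₁ (enum-surj (enum i + x))

    enum-shift : ∀ x i → enum (shift x i) ≈ enum i + x
    enum-shift x i = proj₂ (enum-surj (enum i + x))

    shift-cancel : ∀ {x y} → x + y ≈ 0# → ∀ i → shift y (shift x i) ≡ i
    shift-cancel {x} {y} x+y≈0 i = enum-inj _ _ (begin
      enum (shift y (shift x i)) ≈⟨ enum-shift y (shift x i) ⟩
      enum (shift x i) + y       ≈⟨ +-congʳ (enum-shift x i) ⟩
      enum i + x + y             ≈⟨ +-assoc _ _ _ ⟩
      enum i + (x + y)           ≈⟨ +-congˡ x+y≈0 ⟩
      enum i + 0#                ≈⟨ +-identityʳ _ ⟩
      enum i                     ∎)

    translation : Carrier → Permutation q q
    translation x = permutation (shift x) (shift (- x))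
      (shift-cancel (-‿inverseˡ x)) (shift-cancel (-‿inverseʳ x))

    -- Translation by x permutes the elements, so it does not change their sum.
    size×≈0 : ∀ x → q Mult.× x ≈ 0#
    size×≈0 x = +-identityʳ-unique (sum enum) (q Mult.× x) (begin
      sum enum + q Mult.× x          ≈⟨ +-congˡ (sum-replicate q) ⟨
      sum enum + sum {q} (λ _ → x)   ≈⟨ ∑-distrib-+ enum (λ _ → x) ⟨
      sum (λ i → enum i + x)         ≈⟨ sum-cong-≋ (λ i → sym (enum-shift x i)) ⟩
      sum (λ i → enum (shift x i))   ≈⟨ ∑-permute enum (translation x) ⟨
      sum enum                       ∎)

    ι-size≈0 : ι q ≈ 0#
    ι-size≈0 = trans (reflexive (ι≡×1# q)) (size×≈0 1#)

  module Field (_⁻¹ : Carrier → Carrier) (inverseʳ : ∀ x → ¬ (x ≈ 0#) → x * (x ⁻¹) ≈ 1#)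
               (_≟_ : Decidable _≈_) where

    inverseˡ : ∀ x → ¬ (x ≈ 0#) → x ⁻¹ * x ≈ 1#
    inverseˡ x x≉0 = trans (*-comm _ _) (inverseʳ x x≉0)

    *-cancelˡ : ∀ {w x y} → ¬ (w ≈ 0#) → w * x ≈ w * y → x ≈ y
    *-cancelˡ {w} {x} {y} w≉0 wx≈wy = begin
      x                ≈⟨ *-identityˡ x ⟨
      1# * x           ≈⟨ *-congʳ (inverseˡ w w≉0) ⟨
      w ⁻¹ * w * x     ≈⟨ *-assoc _ _ _ ⟩
      w ⁻¹ * (w * x)   ≈⟨ *-congˡ wx≈wy ⟩
      w ⁻¹ * (w * y)   ≈⟨ *-assoc _ _ _ ⟨
      w ⁻¹ * w * y     ≈⟨ *-congʳ (inverseˡ w w≉0) ⟩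
      1# * y           ≈⟨ *-identityˡ y ⟩
      y                ∎

    x*y≈0⇒x≈0⊎y≈0 : ∀ {x y} → x * y ≈ 0# → x ≈ 0# ⊎ y ≈ 0#
    x*y≈0⇒x≈0⊎y≈0 {x} xy≈0 with x ≟ 0#
    ... | yes x≈0 = inj₁ x≈0
    ... | no  x≉0 = inj₂ (*-cancelˡ x≉0 (trans xy≈0 (sym (zeroʳ x))))

    x*y≉0 : ∀ {x y} → ¬ (x ≈ 0#) → ¬ (y ≈ 0#) → ¬ (x * y ≈ 0#)
    x*y≉0 x≉0 y≉0 xy≈0 = [ x≉0 , y≉0 ]′ (x*y≈0⇒x≈0⊎y≈0 xy≈0)

    x*x≈0⇒x≈0 : ∀ {x} → x * x ≈ 0# → x ≈ 0#
    x*x≈0⇒x≈0 xx≈0 = [ id , id ]′ (x*y≈0⇒x≈0⊎y≈0 xx≈0)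

    x*y⁻¹≈z⇔x≈z*y : ∀ {x y z} → ¬ (y ≈ 0#) → (x * y ⁻¹ ≈ z) ⇔ (x ≈ z * y)
    x*y⁻¹≈z⇔x≈z*y {x} {y} {z} y≉0 = mk⇔
      (λ xy⁻¹≈z → begin
        x                ≈⟨ *-identityʳ x ⟨
        x * 1#           ≈⟨ *-congˡ (inverseˡ y y≉0) ⟨
        x * (y ⁻¹ * y)   ≈⟨ *-assoc _ _ _ ⟨
        x * y ⁻¹ * y     ≈⟨ *-congʳ xy⁻¹≈z ⟩
        z * y            ∎)
      (λ x≈zy → begin
        x * y ⁻¹         ≈⟨ *-congʳ x≈zy ⟩
        z * y * y ⁻¹     ≈⟨ *-assoc _ _ _ ⟩
        z * (y * y ⁻¹)   ≈⟨ *-congˡ (inverseʳ y y≉0) ⟩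
        z * 1#           ≈⟨ *-identityʳ z ⟩
        z                ∎)

    c*d⁻¹*x≈y : ∀ {c d x y} → ¬ (d ≈ 0#) → c * x ≈ d * y → c * d ⁻¹ * x ≈ y
    c*d⁻¹*x≈y {c} {d} {x} {y} d≉0 cx≈dy = begin
      c * d ⁻¹ * x     ≈⟨ *-assoc c (d ⁻¹) x ⟩
      c * (d ⁻¹ * x)   ≈⟨ *-congˡ (*-comm (d ⁻¹) x) ⟩
      c * (x * d ⁻¹)   ≈⟨ *-assoc c x (d ⁻¹) ⟨
      c * x * d ⁻¹     ≈⟨ *-congʳ cx≈dy ⟩
      d * y * d ⁻¹     ≈⟨ Equivalence.from (x*y⁻¹≈z⇔x≈z*y d≉0) (*-comm d y) ⟩
      y                ∎

    ι[p^k]≈0⇒ι[p]≈0 : ¬ (1# ≈ 0#) → ∀ p k → ι (p ^ k) ≈ 0# → ι p ≈ 0#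
    ι[p^k]≈0⇒ι[p]≈0 1≉0 p zero    ι1≈0 = contradiction (trans (sym (+-identityʳ 1#)) ι1≈0) 1≉0
    ι[p^k]≈0⇒ι[p]≈0 1≉0 p (suc k) ι[p^k+1]≈0 = [ id , ι[p^k]≈0⇒ι[p]≈0 1≉0 p k ]′
      (x*y≈0⇒x≈0⊎y≈0 (trans (sym (ι-* p (p ^ k))) ι[p^k+1]≈0))

  module Cubic (_⁻¹ : Carrier → Carrier) (inverseʳ : ∀ x → ¬ (x ≈ 0#) → x * (x ⁻¹) ≈ 1#)
               (_≟_ : Decidable _≈_) where
    open Field _⁻¹ inverseʳ _≟_
    open IntegerSolver using (solve; _:=_; _:+_; _:-_; _:*_; :-_; con)

    OnCubic : Carrier → Carrier → Set ℓ
    OnCubic s t = s * s * s ≈ ι 27 * (t * (1# + s + t))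

    OnCubic-resp : ∀ {s s′ t t′} → s ≈ s′ → t ≈ t′ → OnCubic s t → OnCubic s′ t′
    OnCubic-resp s≈s′ t≈t′ on = begin
      _ ≈⟨ *-cong (*-cong s≈s′ s≈s′) s≈s′ ⟨
      _ ≈⟨ on ⟩
      _ ≈⟨ *-congˡ (*-cong t≈t′ (+-cong (+-congˡ s≈s′) t≈t′)) ⟩
      _ ∎

    s⟨_⟩ : Carrier → Carrier
    s⟨ a ⟩ = ι 3 * a * (a - 1#)

    t⟨_⟩ : Carrier → Carrier
    t⟨ a ⟩ = - (a * a * a)

    Parametrised : Carrier → Carrier → Set (c ⊔ ℓ)
    Parametrised s t = ∃ λ a → s ≈ s⟨ a ⟩ × t ≈ t⟨ a ⟩

    IsSingular : Carrier → Carrier → Set ℓ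
    IsSingular s t = s ≈ - ι 3 × t ≈ 1#

    onCubic-param : ∀ a → OnCubic s⟨ a ⟩ t⟨ a ⟩
    onCubic-param = solve 1 (λ a →
      let s = con (+ 3) :* a :* (a :- con (+ 1)) ; t = :- (a :* a :* a) in
      s :* s :* s := con (+ 27) :* (t :* (con (+ 1) :+ s :+ t))) refl

    onCubic-singular : OnCubic (- ι 3) 1#
    onCubic-singular = solve 0 (let s = :- con (+ 3) in
      s :* s :* s := con (+ 27) :* (con (+ 1) :* (con (+ 1) :+ s :+ con (+ 1)))) refl

    w*w*s⟨a⟩ : ∀ a w → w * w * s⟨ a ⟩ ≈ ι 3 * (a * w) * (a * w - w)
    w*w*s⟨a⟩ = solve 2 (λ a w →
      w :* w :* (con (+ 3) :* a :* (a :- con (+ 1))) := con (+ 3) :* (a :* w) :* (a :* w :- w)) refl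

    w*w*w*t⟨a⟩ : ∀ a w → w * w * w * t⟨ a ⟩ ≈ - (a * w * (a * w) * (a * w))
    w*w*w*t⟨a⟩ = solve 2 (λ a w →
      w :* w :* w :* (:- (a :* a :* a)) := :- (a :* w :* (a :* w) :* (a :* w))) refl

    -- On the parametrisation s + 3 = 3(a² − a + 1) and 3t + s = −3a(a² − a + 1).
    onCubic⇒param : ∀ {s t} → OnCubic s t → ¬ (s + ι 3 ≈ 0#) → Parametrised s t
    onCubic⇒param {s} {t} on w≉0 = a , s≈s⟨a⟩ , t≈t⟨a⟩
      where
      w b a Φ : Carrier
      w = s + ι 3
      b = - (ι 3 * t + s)
      a = b * w ⁻¹
      Φ = ι 27 * (t * (1# + s + t)) - s * s * s

      a*w≈b : a * w ≈ b
      a*w≈b = sym (Equivalence.to (x*y⁻¹≈z⇔x≈z*y w≉0) refl)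

      Φ≈0 : Φ ≈ 0#
      Φ≈0 = x≈y⇒x∙y⁻¹≈ε (sym on)

      s-identity : ι 3 * b * (b - w) ≈ w * w * s + Φ
      s-identity = solve 2 (λ s t →
        let w = s :+ con (+ 3) ; b = :- (con (+ 3) :* t :+ s) in
        con (+ 3) :* b :* (b :- w)
          := w :* w :* s :+ (con (+ 27) :* (t :* (con (+ 1) :+ s :+ t)) :- s :* s :* s)) refl s t

      t-identity : - (b * b * b) ≈ w * w * w * t + (t - 1#) * Φ
      t-identity = solve 2 (λ s t →
        let w = s :+ con (+ 3) ; b = :- (con (+ 3) :* t :+ s) in
        :- (b :* b :* b)
          := w :* w :* w :* t
             :+ (t :- con (+ 1)) :* (con (+ 27) :* (t :* (con (+ 1) :+ s :+ t)) :- s :* s :* s)) refl s t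

      s≈s⟨a⟩ : s ≈ s⟨ a ⟩
      s≈s⟨a⟩ = sym (*-cancelˡ (x*y≉0 w≉0 w≉0) (begin
        w * w * s⟨ a ⟩                  ≈⟨ w*w*s⟨a⟩ a w ⟩
        ι 3 * (a * w) * (a * w - w)     ≈⟨ *-cong (*-congˡ a*w≈b) (+-congʳ a*w≈b) ⟩
        ι 3 * b * (b - w)               ≈⟨ s-identity ⟩
        w * w * s + Φ                   ≈⟨ +-congˡ Φ≈0 ⟩
        w * w * s + 0#                  ≈⟨ +-identityʳ _ ⟩
        w * w * s                       ∎))

      t≈t⟨a⟩ : t ≈ t⟨ a ⟩
      t≈t⟨a⟩ = sym (*-cancelˡ (x*y≉0 (x*y≉0 w≉0 w≉0) w≉0) (begin
        w * w * w * t⟨ a ⟩                   ≈⟨ w*w*w*t⟨a⟩ a w ⟩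
        - (a * w * (a * w) * (a * w))        ≈⟨ -‿cong (*-cong (*-cong a*w≈b a*w≈b) a*w≈b) ⟩
        - (b * b * b)                        ≈⟨ t-identity ⟩
        w * w * w * t + (t - 1#) * Φ         ≈⟨ +-congˡ (trans (*-congˡ Φ≈0) (zeroʳ _)) ⟩
        w * w * w * t + 0#                   ≈⟨ +-identityʳ _ ⟩
        w * w * w * t                        ∎))

    module _ (ι3≉0 : ¬ (ι 3 ≈ 0#)) where

      ι27≉0 : ¬ (ι 27 ≈ 0#)
      ι27≉0 ι27≈0 = x*y≉0 (x*y≉0 ι3≉0 ι3≉0) ι3≉0
        (trans (solve 0 (con (+ 3) :* con (+ 3) :* con (+ 3) := con (+ 27)) refl) ι27≈0)

      onCubic⇒t≈1 : ∀ {t} → OnCubic (- ι 3) t → t ≈ 1#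
      onCubic⇒t≈1 {t} on = x∙y⁻¹≈ε⇒x≈y t 1# (x*x≈0⇒x≈0 (*-cancelˡ ι27≉0 (begin
        ι 27 * ((t - 1#) * (t - 1#))                             ≈⟨ square-identity ⟩
        ι 27 * (t * (1# + - ι 3 + t)) - - ι 3 * - ι 3 * - ι 3    ≈⟨ x≈y⇒x∙y⁻¹≈ε (sym on) ⟩
        0#                                                       ≈⟨ zeroʳ (ι 27) ⟨
        ι 27 * 0#                                                ∎)))
        where
        square-identity : ι 27 * ((t - 1#) * (t - 1#))
                          ≈ ι 27 * (t * (1# + - ι 3 + t)) - - ι 3 * - ι 3 * - ι 3
        square-identity = solve 1 (λ t →
          con (+ 27) :* ((t :- con (+ 1)) :* (t :- con (+ 1)))
            := con (+ 27) :* (t :* (con (+ 1) :+ :- con (+ 3) :+ t))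
               :- :- con (+ 3) :* :- con (+ 3) :* :- con (+ 3)) refl t

      onCubic⇔ : ∀ {s t} → OnCubic s t ⇔ (Parametrised s t ⊎ IsSingular s t)
      onCubic⇔ {s} {t} = mk⇔ to from
        where
        to : OnCubic s t → Parametrised s t ⊎ IsSingular s t
        to on with (s + ι 3) ≟ 0#
        ... | yes s+3≈0 = let s≈-3 = +-inverseˡ-unique s (ι 3) s+3≈0 in
                          inj₂ (s≈-3 , onCubic⇒t≈1 (OnCubic-resp s≈-3 refl on))
        ... | no  s+3≉0 = inj₁ (onCubic⇒param on s+3≉0)

        from : Parametrised s t ⊎ IsSingular s t → OnCubic s t
        from (inj₁ (a , s≈s⟨a⟩ , t≈t⟨a⟩)) = OnCubic-resp (sym s≈s⟨a⟩) (sym t≈t⟨a⟩) (onCubic-param a)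
        from (inj₂ (s≈-3 , t≈1))          = OnCubic-resp (sym s≈-3) (sym t≈1) onCubic-singular

      onCubic⇒s≉0 : ∀ {s t} → ¬ (t * (1# + s + t) ≈ 0#) → OnCubic s t → ¬ (s ≈ 0#)
      onCubic⇒s≉0 {s} {t} D≉0 on s≈0 = D≉0 (*-cancelˡ ι27≉0 (begin
        ι 27 * (t * (1# + s + t))   ≈⟨ on ⟨
        s * s * s                   ≈⟨ *-congˡ s≈0 ⟩
        s * s * 0#                  ≈⟨ zeroʳ (s * s) ⟩
        0#                          ≈⟨ zeroʳ (ι 27) ⟨
        ι 27 * 0#                   ∎))

    sᵘ⟨_⟩ : Carrier → Carrier
    sᵘ⟨ u ⟩ = (ι 3 * ι 4 ⁻¹) * (- 1# + u * u)

    tᵘ⟨_⟩ : Carrier → Carrier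
    tᵘ⟨ u ⟩ = (- (ι 8 ⁻¹)) * ((1# + u) * (1# + u) * (1# + u))

    Parametrisedᵘ : Carrier → Carrier → Set (c ⊔ ℓ)
    Parametrisedᵘ s t = ∃ λ u → ¬ (u ≈ 1#) × ¬ (u ≈ - 1#) × s ≈ sᵘ⟨ u ⟩ × t ≈ tᵘ⟨ u ⟩

    sᵘ⟨±1⟩≈0 : ∀ {u} → u ≈ 1# ⊎ u ≈ - 1# → sᵘ⟨ u ⟩ ≈ 0#
    sᵘ⟨±1⟩≈0 {u} u≈±1 = trans (*-congˡ (-1+u²≈0 u≈±1)) (zeroʳ _)
      where
      -1+u²≈0 : u ≈ 1# ⊎ u ≈ - 1# → - 1# + u * u ≈ 0#
      -1+u²≈0 (inj₁ u≈1)  = trans (+-congˡ (*-cong u≈1 u≈1))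
        (solve 0 (:- con (+ 1) :+ con (+ 1) :* con (+ 1) := con (+ 0)) refl)
      -1+u²≈0 (inj₂ u≈-1) = trans (+-congˡ (*-cong u≈-1 u≈-1))
        (solve 0 (:- con (+ 1) :+ :- con (+ 1) :* :- con (+ 1) := con (+ 0)) refl)

    module _ (ι2≉0 : ¬ (ι 2 ≈ 0#)) where

      ι4≉0 : ¬ (ι 4 ≈ 0#)
      ι4≉0 ι4≈0 = x*y≉0 ι2≉0 ι2≉0
        (trans (solve 0 (con (+ 2) :* con (+ 2) := con (+ 4)) refl) ι4≈0)

      ι8≉0 : ¬ (ι 8 ≈ 0#)
      ι8≉0 ι8≈0 = x*y≉0 (x*y≉0 ι2≉0 ι2≉0) ι2≉0
        (trans (solve 0 (con (+ 2) :* con (+ 2) :* con (+ 2) := con (+ 8)) refl) ι8≈0)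

      sᵘ≈s : ∀ {a u} → u ≈ ι 2 * a - 1# → sᵘ⟨ u ⟩ ≈ s⟨ a ⟩
      sᵘ≈s {a} {u} u≈2a-1 = c*d⁻¹*x≈y ι4≉0 (begin
        ι 3 * (- 1# + u * u)                                ≈⟨ *-congˡ (+-congˡ (*-cong u≈2a-1 u≈2a-1)) ⟩
        ι 3 * (- 1# + (ι 2 * a - 1#) * (ι 2 * a - 1#))      ≈⟨ identity a ⟩
        ι 4 * s⟨ a ⟩                                        ∎)
        where
        identity : ∀ a → ι 3 * (- 1# + (ι 2 * a - 1#) * (ι 2 * a - 1#)) ≈ ι 4 * s⟨ a ⟩
        identity = solve 1 (λ a →
          con (+ 3) :* (:- con (+ 1) :+ (con (+ 2) :* a :- con (+ 1)) :* (con (+ 2) :* a :- con (+ 1)))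
            := con (+ 4) :* (con (+ 3) :* a :* (a :- con (+ 1)))) refl

      tᵘ≈t : ∀ {a u} → u ≈ ι 2 * a - 1# → tᵘ⟨ u ⟩ ≈ t⟨ a ⟩
      tᵘ≈t {a} {u} u≈2a-1 = begin
        tᵘ⟨ u ⟩                                             ≈⟨ *-congʳ (-1*x≈-x (ι 8 ⁻¹)) ⟨
        - 1# * ι 8 ⁻¹ * ((1# + u) * (1# + u) * (1# + u))    ≈⟨ c*d⁻¹*x≈y ι8≉0 -[1+u]³≈8t⟨a⟩ ⟩
        t⟨ a ⟩                                              ∎
        where
        1+u≈2a : 1# + u ≈ ι 2 * a
        1+u≈2a = trans (+-congˡ u≈2a-1)
          (solve 1 (λ a → con (+ 1) :+ (con (+ 2) :* a :- con (+ 1)) := con (+ 2) :* a) refl a)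
        identity : ∀ a → - 1# * (ι 2 * a * (ι 2 * a) * (ι 2 * a)) ≈ ι 8 * t⟨ a ⟩
        identity = solve 1 (λ a →
          :- con (+ 1) :* (con (+ 2) :* a :* (con (+ 2) :* a) :* (con (+ 2) :* a))
            := con (+ 8) :* (:- (a :* a :* a))) refl
        -[1+u]³≈8t⟨a⟩ : - 1# * ((1# + u) * (1# + u) * (1# + u)) ≈ ι 8 * t⟨ a ⟩
        -[1+u]³≈8t⟨a⟩ = begin
          - 1# * ((1# + u) * (1# + u) * (1# + u))    ≈⟨ *-congˡ (*-cong (*-cong 1+u≈2a 1+u≈2a) 1+u≈2a) ⟩
          - 1# * (ι 2 * a * (ι 2 * a) * (ι 2 * a))   ≈⟨ identity a ⟩
          ι 8 * t⟨ a ⟩                               ∎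

      onCubic⇔ᵘ : ¬ (ι 3 ≈ 0#) → ∀ {s t} → ¬ (t * (1# + s + t) ≈ 0#) →
                  OnCubic s t ⇔ (Parametrisedᵘ s t ⊎ IsSingular s t)
      onCubic⇔ᵘ ι3≉0 {s} {t} D≉0 = mk⇔ to from
        where
        open Equivalence (onCubic⇔ ι3≉0) renaming (to to toᵃ; from to fromᵃ)

        to : OnCubic s t → Parametrisedᵘ s t ⊎ IsSingular s t
        to on with toᵃ on
        ... | inj₂ singular               = inj₂ singular
        ... | inj₁ (a , s≈s⟨a⟩ , t≈t⟨a⟩) =
          inj₁ (u , s≉0 ∘ s≈0 ∘ inj₁ , s≉0 ∘ s≈0 ∘ inj₂ , s≈sᵘ , trans t≈t⟨a⟩ (sym (tᵘ≈t refl)))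
          where
          u = ι 2 * a - 1#
          s≉0 = onCubic⇒s≉0 ι3≉0 D≉0 on
          s≈sᵘ : s ≈ sᵘ⟨ u ⟩
          s≈sᵘ = trans s≈s⟨a⟩ (sym (sᵘ≈s refl))
          s≈0 : u ≈ 1# ⊎ u ≈ - 1# → s ≈ 0#
          s≈0 u≈±1 = trans s≈sᵘ (sᵘ⟨±1⟩≈0 u≈±1)

        from : Parametrisedᵘ s t ⊎ IsSingular s t → OnCubic s t
        from (inj₂ singular)                  = fromᵃ (inj₂ singular)
        from (inj₁ (u , _ , _ , s≈sᵘ , t≈tᵘ)) =
          fromᵃ (inj₁ (a , trans s≈sᵘ (sᵘ≈s u≈2a-1) , trans t≈tᵘ (tᵘ≈t u≈2a-1)))
          where
          a = (1# + u) * ι 2 ⁻¹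
          u≈2a-1 : u ≈ ι 2 * a - 1#
          u≈2a-1 = begin
            u                 ≈⟨ solve 1 (λ u → u := con (+ 1) :+ u :- con (+ 1)) refl u ⟩
            1# + u - 1#       ≈⟨ +-congʳ (Equivalence.to (x*y⁻¹≈z⇔x≈z*y ι2≉0) refl) ⟩
            a * ι 2 - 1#      ≈⟨ +-congʳ (*-comm a (ι 2)) ⟩
            ι 2 * a - 1#      ∎

lemma6p18 : ∀ {c ℓ} (p q k : ℕ) → Prime p → 5 ≤ p → q ≡ p ^ k →
    (F : CommutativeRing c ℓ) → (FF : IsFiniteField F q) →
    let open CommutativeRing F
        open IsFiniteField FF
        open FieldOps F
    in ∀ (s t : Carrier) → ¬ (t * (1# + s + t) ≈ 0#) →
       ((s * s * s) * (t * (1# + s + t)) ⁻¹ ≈ ι 27)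
       ⇔ ((∃ λ (u : Carrier) → ¬ (u ≈ 1#) × ¬ (u ≈ - 1#)
             × s ≈ (ι 3 * ι 4 ⁻¹) * (- 1# + u * u)
             × t ≈ (- (ι 8 ⁻¹)) * ((1# + u) * (1# + u) * (1# + u)))
          ⊎ (s ≈ - ι 3 × t ≈ 1#))
lemma6p18 p q k p-prime 5≤p q≡pᵏ F FF s t D≉0 =
  ⇔-trans (x*y⁻¹≈z⇔x≈z*y D≉0) (onCubic⇔ᵘ (ι≉0 2 2<p) (ι≉0 3 3<p) D≉0)
  where
  open CommutativeRing F
  open IsFiniteField FF
  open FieldOps F
  open FiniteRing F enum enum-inj enum-surj using (ι-size≈0)
  open Field F _⁻¹ inverseʳ _≟_ using (x*y⁻¹≈z⇔x≈z*y; ι[p^k]≈0⇒ι[p]≈0)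
  open Cubic F _⁻¹ inverseʳ _≟_ using (onCubic⇔ᵘ)

  ιp≈0 : ι p ≈ 0#
  ιp≈0 = ι[p^k]≈0⇒ι[p]≈0 1≉0 p k (≡.subst (λ n → ι n ≈ 0#) q≡pᵏ ι-size≈0)

  ι≉0 : ∀ n .{{_ : ℕ.NonZero n}} → n ℕ.< p → ¬ (ι n ≈ 0#)
  ι≉0 n n<p = ι≉0-coprime F 1≉0 ιp≈0 (prime⇒coprime p-prime n<p)

  2<p : 2 ℕ.< p
  2<p = ℕ.≤-trans (ℕ.m≤m+n 3 2) 5≤p

  3<p : 3 ℕ.< p
  3<p = ℕ.≤-trans (ℕ.m≤m+n 4 1) 5≤p
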